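{- For all positive integers $r,n$, \[\sum_{g\in G_{r,n}} q^{exc_r(g)}=\sum_{g\in G_{r,n}} q^{ldes_F(g)}.\]
   Context: $G_{r,n}$ is the set of pairs $g=(z,\pi)$ with $z\in\{0,\dots,r-1\}^n$, $\pi\in S_n$ (the wreath product $C_r\wr S_n$); $csum(g)=\sum_i z_i$. Friends order $F$: $1^{[r-1]}<\dots<1^{[0]}<2^{[r-1]}<\dots<2^{[0]}<\dots<n^{[r-1]}<\dots<n^{[0]}$; $des_F(g)=|\{1\le i\le n-1:\pi(i)^{[z_i]}>_F\pi(i+1)^{[z_{i+1}]}\}|$ and $ldes_F(g)=des_F(g)+csum(g)$. For $\pi\in S_n$, $exc(\pi)=|\{i:\pi(i)>i\}|$, and $exc_r(g)=exc(\pi)+csum(g)$. -}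

module Defs where

open import Data.Nat using (ℕ; zero; suc; _+_; _<_; _<?_)
open import Data.Nat.Properties using () renaming (_≟_ to _≟ℕ_)
open import Data.Fin using (Fin; toℕ)
open import Data.Fin.Properties using () renaming (_≟_ to _≟F_)
open import Data.Vec using (Vec; []; _∷_; toList; zip)
open import Data.List using (List; []; _∷_; map; length; filter; allFin; concatMap)
open import Data.Nat.ListAction using (sum)
open import Data.Product using (_×_; _,_; proj₁; proj₂)
open import Data.Sum using (_⊎_)
open import Relation.Binary.PropositionalEquality using (_≡_)
open import Relation.Nullary using (Dec; yes; no)
open import Relation.Nullary.Decidable using (_⊎-dec_; _×-dec_)
import Data.List.Relation.Unary.Unique.DecPropositional as UniqueDec

allVecs : {A : Set} → List A → (n : ℕ) → List (Vec A n)
allVecs xs zero    = [] ∷ []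
allVecs xs (suc n) = concatMap (λ x → map (x ∷_) (allVecs xs n)) xs

-- A permutation π ∈ S_n, written in one-line notation (π(1),…,π(n)),
-- with the values 1..n represented by Fin n (value j+1 ↔ toℕ j = j).
-- A word of length n over Fin n is a permutation iff its entries are distinct.
IsPerm : {n : ℕ} → Vec (Fin n) n → Set
IsPerm {n} π = UniqueDec.Unique (_≟F_ {n}) (toList π)

isPerm? : {n : ℕ} → (π : Vec (Fin n) n) → Dec (IsPerm π)
isPerm? {n} π = UniqueDec.unique? (_≟F_ {n}) (toList π)

-- The elements of G_{r,n} = C_r ≀ S_n: pairs (z , π), z ∈ {0..r-1}^n, π ∈ S_n.
Elt : ℕ → ℕ → Set
Elt r n = Vec (Fin r) n × Vec (Fin n) n

G : (r n : ℕ) → List (Elt r n)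
G r n = concatMap (λ z → map (z ,_) (filter isPerm? (allVecs (allFin n) n)))
                  (allVecs (allFin r) n)

csum : {r n : ℕ} → Elt r n → ℕ
csum (z , π) = sum (map toℕ (toList z))

-- exc(π) = #{ i : π(i) > i }   (positions i = 1..n, values 1..n; both shifted by 1)
excList : ℕ → {n : ℕ} → List (Fin n) → ℕ
excList i []       = 0
excList i (p ∷ ps) with i <? toℕ p
... | yes _ = suc (excList (suc i) ps)
... | no  _ = excList (suc i) ps

exc : {n : ℕ} → Vec (Fin n) n → ℕ
exc π = excList 0 (toList π)

exc-r : {r n : ℕ} → Elt r n → ℕ
exc-r g = exc (proj₂ g) + csum g

-- Friends order on coloured letters a^{[c]} (letter a, colour c):
-- 1^{[r-1]} < … < 1^{[0]} < 2^{[r-1]} < … < 2^{[0]} < … < n^{[r-1]} < … < n^{[0]}.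
-- a^{[c]} >_F b^{[d]}  iff  a > b, or a = b and c < d.
_>F_ : {r n : ℕ} → (Fin n × Fin r) → (Fin n × Fin r) → Set
(a , c) >F (b , d) = (toℕ b < toℕ a) ⊎ ((toℕ a ≡ toℕ b) × (toℕ c < toℕ d))

_>F?_ : {r n : ℕ} → (x y : Fin n × Fin r) → Dec (x >F y)
(a , c) >F? (b , d) = (toℕ b <? toℕ a) ⊎-dec ((toℕ a ≟ℕ toℕ b) ×-dec (toℕ c <? toℕ d))

desFrom : {r n : ℕ} → (Fin n × Fin r) → List (Fin n × Fin r) → ℕ
desFrom x []       = 0
desFrom x (y ∷ ws) with x >F? y
... | yes _ = suc (desFrom y ws)
... | no  _ = desFrom y ws

desList : {r n : ℕ} → List (Fin n × Fin r) → ℕ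
desList []       = 0
desList (x ∷ ws) = desFrom x ws

des-F : {r n : ℕ} → Elt r n → ℕ
des-F (z , π) = desList (toList (zip π z))

ldes-F : {r n : ℕ} → Elt r n → ℕ
ldes-F g = des-F g + csum g

-- Coefficient of q^k in Σ_{g ∈ G_{r,n}} q^{stat(g)}.
coeff : (r n : ℕ) → (Elt r n → ℕ) → ℕ → ℕ
coeff r n stat k = length (filter (λ g → stat g ≟ℕ k) (G r n))

{-# OPTIONS --safe #-}
-- Adjacent letters of a permutation are distinct, so colours never decide a comparison in the
-- Friends order and des_F (z , π) = des π.  Hence exc_r and ldes_F add the same csum z to exc π and
-- des π, and it suffices that exc and des are equidistributed on S_n.  Both obey the Eulerian
-- recurrence: inserting the new largest letter n into a permutation of 0 … n-1 with d descents, at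
-- each of the n + 1 positions, gives d + 1 permutations with d descents and n - d with d + 1;
-- inserting n into the cycle notation (π(j) := n and n ↦ old π(j), or n as a fixed point) does the
-- same for excedances.  Each insertion scheme lists S_(n+1) exactly once, so des and exc take every
-- value equally often.
module Submission where

open import Defs
open import Data.Bool using (true; false)
open import Data.Nat using (ℕ; zero; suc; _+_; _∸_; _≤_; _<_; z≤n; s≤s; z<s; s≤s⁻¹; _<?_)
open import Data.Nat.Properties
  using (_≟_; ≤-refl; ≤-reflexive; ≤-trans; <⇒≤; ≤⇒≯; <⇒≱; <-irrefl; n<1+n; m<m+n; +-mono-≤; +-identityʳ; +-suc;
         +-∸-assoc; module ≤-Reasoning)
open import Data.Nat.ListAction using (sum)
open import Data.Fin using (Fin; toℕ; fromℕ<)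
open import Data.Fin.Properties using (toℕ-injective; toℕ<n; toℕ-fromℕ<)
open import Data.Vec using (Vec; []; _∷_; toList; zip)
import Data.Vec.Properties as Vec
open import Data.List
  using (List; []; _∷_; [_]; _++_; _∷ʳ_; map; length; replicate; filter; upTo; applyUpTo; allFin; concat; concatMap;
         cartesianProductWith; cartesianProduct)
import Data.List.Properties as List
open import Data.List.Relation.Unary.All as All using (All; []; _∷_)
open import Data.List.Relation.Unary.Any as Any using (here; there)
open import Data.List.Membership.Propositional using (_∈_; _∉_)
open import Data.List.Membership.Propositional.Properties
  using (∈-map⁺; ∈-map⁻; ∈-filter⁺; ∈-filter⁻; ∈-allFin; ∈-upTo⁺; ∈-upTo⁻; ∈-∃++;
         ∈-cartesianProductWith⁺; ∈-cartesianProductWith⁻)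
open import Data.List.Membership.Propositional.Properties.WithK using (unique∧set⇒bag)
open import Data.List.Membership.DecPropositional _≟_ using (_∈?_)
open import Data.List.Relation.Binary.Subset.Propositional using (_⊆_)
open import Data.List.Relation.Unary.Unique.Propositional using (Unique; []; _∷_)
import Data.List.Relation.Unary.Unique.Propositional.Properties as Unique
open import Data.List.Relation.Binary.BagAndSetEquality using (∼bag⇒↭)
open import Data.List.Relation.Binary.Permutation.Propositional
  using (_↭_; ↭-refl; ↭-sym; ↭-trans; ↭-reflexive; ↭-prep; ↭-swap; ↭⇒↭ₛ; module PermutationReasoning)
open import Data.List.Relation.Binary.Permutation.Propositional.Properties
  using (map⁺; ++⁺; ++⁺ˡ; ++⁺ʳ; shift; shifts; drop-∷; ∷↭∷ʳ; ∈-resp-↭; ↭-length; ↭-empty-inv; filter-↭)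
import Data.List.Relation.Binary.Permutation.Setoid.Properties as ↭ₛ
open import Data.Product as Product using (_×_; _,_; proj₂; ∃; ∃₂)
open import Data.Sum using (inj₁; inj₂)
open import Function using (id; _∘_)
open import Function.Bundles using (mk⇔)
open import Relation.Binary.PropositionalEquality
  using (_≡_; refl; sym; trans; cong; cong₂; subst; setoid; module ≡-Reasoning)
open import Relation.Nullary using (Dec; yes; no; does; ¬_; contradiction)
open import Relation.Unary using (Pred; Decidable)

private variable
  A B C D : Set

concatMap⁺ : (f : A → List B) {xs ys : List A} → xs ↭ ys → concatMap f xs ↭ concatMap f ys
concatMap⁺ f _↭_.refl          = ↭-refl
concatMap⁺ f (_↭_.prep x p)    = ++⁺ˡ (f x) (concatMap⁺ f p)
concatMap⁺ f (_↭_.swap x y p)  = ↭-trans (shifts (f x) (f y)) (++⁺ˡ (f y) (++⁺ˡ (f x) (concatMap⁺ f p)))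
concatMap⁺ f (_↭_.trans p q)   = ↭-trans (concatMap⁺ f p) (concatMap⁺ f q)

concatMap-map≡cartesianProductWith : (f : A → B → C) (xs : List A) (ys : List B) →
  concatMap (λ x → map (f x) ys) xs ≡ cartesianProductWith f xs ys
concatMap-map≡cartesianProductWith f []       ys = refl
concatMap-map≡cartesianProductWith f (x ∷ xs) ys =
  cong (map (f x) ys ++_) (concatMap-map≡cartesianProductWith f xs ys)

map-cartesianProductWith-↭ : (g : C → D) (f : A → B → C) {F : A → List D} (xs : List A) (ys : List B) →
  (∀ {x} → x ∈ xs → map (g ∘ f x) ys ↭ F x) → map g (cartesianProductWith f xs ys) ↭ concatMap F xs
map-cartesianProductWith-↭ g f []       ys _  = ↭-refl
map-cartesianProductWith-↭ g f (x ∷ xs) ys hyp = begin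
  map g (map (f x) ys ++ cartesianProductWith f xs ys)
    ≡⟨ List.map-++ g (map (f x) ys) _ ⟩
  map g (map (f x) ys) ++ map g (cartesianProductWith f xs ys)
    ≡⟨ cong (_++ _) (List.map-∘ ys) ⟨
  map (g ∘ f x) ys ++ map g (cartesianProductWith f xs ys)
    ↭⟨ ++⁺ (hyp (here refl)) (map-cartesianProductWith-↭ g f xs ys (hyp ∘ there)) ⟩
  concatMap _ (x ∷ xs) ∎
  where open PermutationReasoning

cartesianProductWith⁺-retraction : (f : A → B → C) (g : C → A × B) {xs : List A} {ys : List B} →
  (∀ {x y} → x ∈ xs → y ∈ ys → g (f x y) ≡ (x , y)) →
  Unique xs → Unique ys → Unique (cartesianProductWith f xs ys)
cartesianProductWith⁺-retraction f g {xs} {ys} g∘f≡id xs! ys! =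
  Unique.map⁻ (subst Unique (sym (map-g xs g∘f≡id)) (Unique.cartesianProduct⁺ xs! ys!))
  where
  map-g : ∀ xs′ → (∀ {x y} → x ∈ xs′ → y ∈ ys → g (f x y) ≡ (x , y)) →
          map g (cartesianProductWith f xs′ ys) ≡ cartesianProduct xs′ ys
  map-g []        _   = refl
  map-g (x ∷ xs′) inv = begin
    map g (map (f x) ys ++ cartesianProductWith f xs′ ys)
      ≡⟨ List.map-++ g (map (f x) ys) _ ⟩
    map g (map (f x) ys) ++ map g (cartesianProductWith f xs′ ys)
      ≡⟨ cong₂ _++_ (sym (List.map-∘ ys)) (map-g xs′ (inv ∘ there)) ⟩
    map (g ∘ f x) ys ++ cartesianProduct xs′ ys
      ≡⟨ cong (_++ _) (List.map-cong-local (All.tabulate (inv (here refl)))) ⟩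
    map (x ,_) ys ++ cartesianProduct xs′ ys ∎
    where open ≡-Reasoning

filter-map : ∀ {p} (f : A → B) {P : Pred B p} (P? : Decidable P) xs →
             filter P? (map f xs) ≡ map f (filter (P? ∘ f) xs)
filter-map f P? []       = refl
filter-map f P? (x ∷ xs) with does (P? (f x))
... | true  = cong (f x ∷_) (filter-map f P? xs)
... | false = filter-map f P? xs

count-↭ : (f g : A → ℕ) (k : ℕ) (xs : List A) → map f xs ↭ map g xs →
  length (filter (λ x → f x ≟ k) xs) ≡ length (filter (λ x → g x ≟ k) xs)
count-↭ f g k xs f[xs]↭g[xs] = begin
  length (filter ((_≟ k) ∘ f) xs)          ≡⟨ List.length-map f (filter ((_≟ k) ∘ f) xs) ⟨
  length (map f (filter ((_≟ k) ∘ f) xs))  ≡⟨ cong length (filter-map f (_≟ k) xs) ⟨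
  length (filter (_≟ k) (map f xs))        ≡⟨ ↭-length (filter-↭ (_≟ k) f[xs]↭g[xs]) ⟩
  length (filter (_≟ k) (map g xs))        ≡⟨ cong length (filter-map g (_≟ k) xs) ⟩
  length (map g (filter ((_≟ k) ∘ g) xs))  ≡⟨ List.length-map g (filter ((_≟ k) ∘ g) xs) ⟩
  length (filter ((_≟ k) ∘ g) xs)          ∎
  where open ≡-Reasoning

upTo-suc-↭ : ∀ n → upTo (suc n) ↭ n ∷ upTo n
upTo-suc-↭ n = ↭-sym (↭-trans (∷↭∷ʳ n (upTo n)) (↭-reflexive (List.upTo-∷ʳ n)))

↭-upTo⇒length : ∀ {n w} → w ↭ upTo n → length w ≡ n
↭-upTo⇒length {n} w↭ = trans (↭-length w↭) (List.length-upTo n)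

↭-upTo⇒All< : ∀ {n w} → w ↭ upTo n → All (_< n) w
↭-upTo⇒All< w↭ = All.tabulate (∈-upTo⁻ ∘ ∈-resp-↭ w↭)

Unique-resp-↭ : {xs ys : List A} → xs ↭ ys → Unique xs → Unique ys
Unique-resp-↭ = ↭ₛ.Unique-resp-↭ (setoid _) ∘ ↭⇒↭ₛ

∈⇒↭∷ : ∀ {y : A} {w} → y ∈ w → ∃ λ w′ → w ↭ y ∷ w′
∈⇒↭∷ {y = y} y∈w with u , v , refl ← ∈-∃++ y∈w = u ++ v , shift y u v

⊆-∷⇒⊆ : ∀ {y : A} {w ys} → y ∉ w → w ⊆ y ∷ ys → w ⊆ ys
⊆-∷⇒⊆ y∉w w⊆ x∈w = Any.tail (λ { refl → y∉w x∈w }) (w⊆ x∈w)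

unique-∈-⊆∷⇒↭∷ : ∀ {y : A} {w ys} → Unique w → w ⊆ y ∷ ys → y ∈ w →
                  ∃ λ w′ → w ↭ y ∷ w′ × Unique w′ × w′ ⊆ ys
unique-∈-⊆∷⇒↭∷ w! w⊆ y∈w with w′ , w↭y∷w′ ← ∈⇒↭∷ y∈w with y∉w′ ∷ w′! ← Unique-resp-↭ w↭y∷w′ w! =
  w′ , w↭y∷w′ , w′! , ⊆-∷⇒⊆ (λ y∈w′ → All.lookup y∉w′ y∈w′ refl) (w⊆ ∘ ∈-resp-↭ (↭-sym w↭y∷w′) ∘ there)

unique-⊆⇒++↭ : ∀ (ys : List ℕ) {w} → Unique w → w ⊆ ys → ∃ λ t → w ++ t ↭ ys
unique-⊆⇒++↭ []       {[]}    _  _   = [] , ↭-refl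
unique-⊆⇒++↭ []       {x ∷ w} _  w⊆ with () ← w⊆ (here refl)
unique-⊆⇒++↭ (y ∷ ys) {w}     w! w⊆ with y ∈? w
... | no y∉w with t , w++t↭ys ← unique-⊆⇒++↭ ys w! (⊆-∷⇒⊆ y∉w w⊆) =
  y ∷ t , ↭-trans (shift y w t) (↭-prep y w++t↭ys)
... | yes y∈w with w′ , w↭y∷w′ , w′! , w′⊆ys ← unique-∈-⊆∷⇒↭∷ w! w⊆ y∈w
                 with t , w′++t↭ys ← unique-⊆⇒++↭ ys w′! w′⊆ys =
  t , ↭-trans (++⁺ʳ t w↭y∷w′) (↭-prep y w′++t↭ys)

unique-⊆-length⇒↭ : ∀ ys {w : List ℕ} → Unique w → w ⊆ ys → length ys ≤ length w → w ↭ ys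
unique-⊆-length⇒↭ ys {w} w! w⊆ys ∣ys∣≤∣w∣ with unique-⊆⇒++↭ ys w! w⊆ys
... | []    , w++[]↭ys = ↭-trans (↭-reflexive (sym (List.++-identityʳ w))) w++[]↭ys
... | x ∷ t , w++t↭ys  = contradiction ∣ys∣≤∣w∣ (<⇒≱ (begin-strict
  length w                 <⟨ m<m+n (length w) z<s ⟩
  length w + length (x ∷ t) ≡⟨ List.length-++ w ⟨
  length (w ++ x ∷ t)      ≡⟨ ↭-length w++t↭ys ⟩
  length ys                ∎))
  where open ≤-Reasoning

𝟙[_] : {P : Set} → Dec P → ℕ
𝟙[ yes _ ] = 1
𝟙[ no  _ ] = 0

𝟙-yes : {P : Set} (p? : Dec P) → P → 𝟙[ p? ] ≡ 1
𝟙-yes (yes _) _ = refl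
𝟙-yes (no ¬p) p = contradiction p ¬p

𝟙-no : {P : Set} (p? : Dec P) → ¬ P → 𝟙[ p? ] ≡ 0
𝟙-no (yes p) ¬p = contradiction p ¬p
𝟙-no (no _)  _  = refl

𝟙≤1 : {P : Set} (p? : Dec P) → 𝟙[ p? ] ≤ 1
𝟙≤1 (yes _) = ≤-refl
𝟙≤1 (no _)  = z≤n

excFrom : ℕ → List ℕ → ℕ
excFrom i []      = 0
excFrom i (p ∷ w) = 𝟙[ i <? p ] + excFrom (suc i) w

-- desAfter x w counts the descents of x ∷ w; nothing lies below 0, so desAfter 0 w is des w.
desAfter : ℕ → List ℕ → ℕ
desAfter x []      = 0
desAfter x (y ∷ w) = 𝟙[ y <? x ] + desAfter y w

excFrom≤length : ∀ i w → excFrom i w ≤ length w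
excFrom≤length i []      = z≤n
excFrom≤length i (p ∷ w) = +-mono-≤ (𝟙≤1 (i <? p)) (excFrom≤length (suc i) w)

desAfter≤length : ∀ x w → desAfter x w ≤ length w
desAfter≤length x []      = z≤n
desAfter≤length x (y ∷ w) = +-mono-≤ (𝟙≤1 (y <? x)) (desAfter≤length y w)

-- The statistic values of the m + 1 insertions of a new largest letter into a permutation of
-- length m on which the statistic is d.
eulerianStep : ℕ → ℕ → List ℕ
eulerianStep d m = replicate (suc d) d ++ replicate (m ∸ d) (suc d)

eulerianStep-∷ : ∀ {d m} → d ≤ m → suc d ∷ eulerianStep d m ↭ eulerianStep d (suc m)
eulerianStep-∷ {d} {m} d≤m = begin
  suc d ∷ replicate (suc d) d ++ replicate (m ∸ d) (suc d)
    ↭⟨ shift (suc d) (replicate (suc d) d) _ ⟨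
  replicate (suc d) d ++ replicate (suc (m ∸ d)) (suc d)
    ≡⟨ cong (λ k → replicate (suc d) d ++ replicate k (suc d)) (+-∸-assoc 1 d≤m) ⟨
  eulerianStep d (suc m) ∎
  where open PermutationReasoning

map-suc-eulerianStep : ∀ d m → suc d ∷ map suc (eulerianStep d m) ≡ eulerianStep (suc d) (suc m)
map-suc-eulerianStep d m = cong (suc d ∷_) (begin
  map suc (replicate (suc d) d ++ replicate (m ∸ d) (suc d))
    ≡⟨ List.map-++ suc (replicate (suc d) d) _ ⟩
  map suc (replicate (suc d) d) ++ map suc (replicate (m ∸ d) (suc d))
    ≡⟨ cong₂ _++_ (List.map-replicate suc (suc d) d) (List.map-replicate suc (m ∸ d) (suc d)) ⟩
  replicate (suc d) (suc d) ++ replicate (m ∸ d) (suc (suc d)) ∎)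
  where open ≡-Reasoning

eulerianStep-prepend : ∀ {P : Set} (p? : Dec P) {d m xs} → xs ↭ eulerianStep d m → d ≤ m →
                       suc d ∷ map (𝟙[ p? ] +_) xs ↭ eulerianStep (𝟙[ p? ] + d) (suc m)
eulerianStep-prepend (yes _) {d} {m} xs↭ _ =
  ↭-trans (↭-prep (suc d) (map⁺ suc xs↭)) (↭-reflexive (map-suc-eulerianStep d m))
eulerianStep-prepend (no _) {xs = xs} xs↭ d≤m =
  ↭-trans (↭-prep _ (↭-trans (↭-reflexive (List.map-id xs)) xs↭)) (eulerianStep-∷ d≤m)

-- d occurs in eulerian n as often as the Eulerian number A(n, d) says.
eulerian : ℕ → List ℕ
eulerian zero    = [ 0 ]
eulerian (suc n) = concatMap (λ d → eulerianStep d n) (eulerian n)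

insertWith : (List ℕ → List ℕ) → ℕ → List ℕ → ℕ → List ℕ
insertWith τ v w       zero    = v ∷ τ w
insertWith τ v []      (suc j) = v ∷ τ []
insertWith τ v (x ∷ w) (suc j) = x ∷ insertWith τ v w j

insertWith-++ : ∀ τ v u t → insertWith τ v (u ++ t) (length u) ≡ u ++ v ∷ τ t
insertWith-++ τ v []      t = refl
insertWith-++ τ v (x ∷ u) t = cong (x ∷_) (insertWith-++ τ v u t)

insertAt : ℕ → List ℕ → ℕ → List ℕ
insertAt = insertWith id

rotateLeft : List ℕ → List ℕ
rotateLeft []      = []
rotateLeft (x ∷ w) = w ∷ʳ x

rotateRight : List ℕ → List ℕ
rotateRight []      = []
rotateRight (a ∷ w) with rotateRight w
... | []    = [ a ]
... | y ∷ t = y ∷ a ∷ t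

rotateRight∘rotateLeft : ∀ w → rotateRight (rotateLeft w) ≡ w
rotateRight∘rotateLeft []      = refl
rotateRight∘rotateLeft (x ∷ w) = rotateRight-∷ʳ w
  where
  rotateRight-∷ʳ : ∀ w → rotateRight (w ∷ʳ x) ≡ x ∷ w
  rotateRight-∷ʳ []      = refl
  rotateRight-∷ʳ (a ∷ w) rewrite rotateRight-∷ʳ w = refl

rotateLeft∘rotateRight : ∀ w → rotateLeft (rotateRight w) ≡ w
rotateLeft∘rotateRight []      = refl
rotateLeft∘rotateRight (a ∷ w) with rotateRight w | rotateLeft∘rotateRight w
... | []    | []≡w = cong (a ∷_) []≡w
... | y ∷ t | t∷ʳy≡w = cong (a ∷_) t∷ʳy≡w

rotateLeft-↭ : ∀ w → rotateLeft w ↭ w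
rotateLeft-↭ []      = ↭-refl
rotateLeft-↭ (x ∷ w) = ↭-sym (∷↭∷ʳ x w)

-- Position j takes v and its old entry moves to the end: in cycle notation v is inserted right
-- after j, or as a fixed point when j = length w.
cycleInsert : ℕ → List ℕ → ℕ → List ℕ
cycleInsert = insertWith rotateLeft

desAfter-insertAt : ∀ {v x} w → x ≤ v → All (_< v) w →
  applyUpTo (desAfter x ∘ insertAt v w) (suc (length w)) ↭ eulerianStep (desAfter x w) (length w)
desAfter-insertAt {v} {x} [] x≤v [] rewrite 𝟙-no (v <? x) (≤⇒≯ x≤v) = ↭-refl
desAfter-insertAt {v} {x} (y ∷ w) x≤v (y<v ∷ w<v) = begin
  desAfter x (v ∷ y ∷ w) ∷ applyUpTo (λ j → 𝟙[ y <? x ] + desAfter y (insertAt v w j)) (suc (length w))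
    ≡⟨ cong₂ _∷_ new-descent (sym (List.map-applyUpTo (desAfter y ∘ insertAt v w) (𝟙[ y <? x ] +_) _)) ⟩
  suc (desAfter y w) ∷ map (𝟙[ y <? x ] +_) (applyUpTo (desAfter y ∘ insertAt v w) (suc (length w)))
    ↭⟨ eulerianStep-prepend (y <? x) (desAfter-insertAt w (<⇒≤ y<v) w<v) (desAfter≤length y w) ⟩
  eulerianStep (desAfter x (y ∷ w)) (length (y ∷ w)) ∎
  where
  open PermutationReasoning
  new-descent : desAfter x (v ∷ y ∷ w) ≡ suc (desAfter y w)
  new-descent rewrite 𝟙-no (v <? x) (≤⇒≯ x≤v) | 𝟙-yes (y <? v) y<v = refl

excFrom-∷ʳ : ∀ i w {x} → x ≤ i + length w → excFrom i (w ∷ʳ x) ≡ excFrom i w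
excFrom-∷ʳ i [] {x} x≤i rewrite 𝟙-no (i <? x) (≤⇒≯ (≤-trans x≤i (≤-reflexive (+-identityʳ i)))) = refl
excFrom-∷ʳ i (p ∷ w) x≤ =
  cong (𝟙[ i <? p ] +_) (excFrom-∷ʳ (suc i) w (≤-trans x≤ (≤-reflexive (+-suc i (length w)))))

excFrom-cycleInsert : ∀ {v} i w → i + length w ≡ v → All (_< v) w →
  applyUpTo (excFrom i ∘ cycleInsert v w) (suc (length w)) ↭ eulerianStep (excFrom i w) (length w)
excFrom-cycleInsert i [] refl [] rewrite 𝟙-no (i <? i + 0) (≤⇒≯ (≤-reflexive (+-identityʳ i))) = ↭-refl
excFrom-cycleInsert i (p ∷ w) refl (p<v ∷ w<v) = begin
  excFrom i (v ∷ w ∷ʳ p) ∷ applyUpTo (λ j → 𝟙[ i <? p ] + excFrom (suc i) (cycleInsert v w j)) (suc ∣w∣)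
    ≡⟨ cong₂ _∷_ new-excedance (sym (List.map-applyUpTo (excFrom (suc i) ∘ cycleInsert v w) _ _)) ⟩
  suc (excFrom (suc i) w) ∷ map (𝟙[ i <? p ] +_) (applyUpTo (excFrom (suc i) ∘ cycleInsert v w) (suc ∣w∣))
    ↭⟨ eulerianStep-prepend (i <? p) (excFrom-cycleInsert (suc i) w (sym (+-suc i ∣w∣)) w<v)
                                     (excFrom≤length (suc i) w) ⟩
  eulerianStep (excFrom i (p ∷ w)) (length (p ∷ w)) ∎
  where
  open PermutationReasoning
  ∣w∣ v : ℕ
  ∣w∣ = length w
  v = i + suc ∣w∣
  new-excedance : excFrom i (v ∷ w ∷ʳ p) ≡ suc (excFrom (suc i) w)
  new-excedance rewrite 𝟙-yes (i <? v) (m<m+n i z<s) =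
    cong suc (excFrom-∷ʳ (suc i) w (<⇒≤ (subst (p <_) (+-suc i _) p<v)))

module InsertionEnumeration
  (τ τ⁻¹ : List ℕ → List ℕ) (τ⁻¹∘τ : ∀ w → τ⁻¹ (τ w) ≡ w) (τ∘τ⁻¹ : ∀ w → τ (τ⁻¹ w) ≡ w)
  (τ-↭ : ∀ w → τ w ↭ w)
  where

  insert-↭ : ∀ v w j → insertWith τ v w j ↭ v ∷ w
  insert-↭ v w       zero    = ↭-prep v (τ-↭ w)
  insert-↭ v []      (suc j) = ↭-prep v (τ-↭ [])
  insert-↭ v (x ∷ w) (suc j) = ↭-trans (↭-prep x (insert-↭ v w j)) (↭-swap x v ↭-refl)

  ∈⇒insert : ∀ {v w} → v ∈ w → ∃₂ λ u j → j ≤ length u × insertWith τ v u j ≡ w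
  ∈⇒insert {v} v∈w with u , t , refl ← ∈-∃++ v∈w =
    u ++ τ⁻¹ t , length u , List.length-++-≤ˡ u ,
    trans (insertWith-++ τ v u (τ⁻¹ t)) (cong (λ t′ → u ++ v ∷ t′) (τ∘τ⁻¹ t))

  remove : ℕ → List ℕ → List ℕ × ℕ
  remove v []      = [] , 0
  remove v (x ∷ w) with x ≟ v
  ... | yes _ = τ⁻¹ w , 0
  ... | no  _ = Product.map (x ∷_) suc (remove v w)

  remove-insert : ∀ {v} w j → v ∉ w → j ≤ length w → remove v (insertWith τ v w j) ≡ (w , j)
  remove-insert {v} w zero _ _ with v ≟ v
  ... | yes _   = cong (_, 0) (τ⁻¹∘τ w)
  ... | no v≢v = contradiction refl v≢v
  remove-insert {v} (x ∷ w) (suc j) v∉ (s≤s j≤) with x ≟ v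
  ... | yes refl = contradiction (here refl) v∉
  ... | no  _    = cong (Product.map (x ∷_) suc) (remove-insert w j (v∉ ∘ there) j≤)

  perms : ℕ → List (List ℕ)
  perms zero    = [ [] ]
  perms (suc n) = cartesianProductWith (insertWith τ n) (perms n) (upTo (suc n))

  ∈-perms⁻ : ∀ n {w} → w ∈ perms n → w ↭ upTo n
  ∈-perms⁻ zero    (here refl) = ↭-refl
  ∈-perms⁻ (suc n) w∈
    with u , j , u∈ , _ , refl ← ∈-cartesianProductWith⁻ (insertWith τ n) (perms n) (upTo (suc n)) w∈ =
    ↭-trans (insert-↭ n u j) (↭-trans (↭-prep n (∈-perms⁻ n u∈)) (↭-sym (upTo-suc-↭ n)))

  ∈-perms⁺ : ∀ n {w} → w ↭ upTo n → w ∈ perms n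
  ∈-perms⁺ zero    w↭ rewrite ↭-empty-inv w↭ = here refl
  ∈-perms⁺ (suc n) w↭ with u , j , j≤∣u∣ , refl ← ∈⇒insert (∈-resp-↭ (↭-sym w↭) (∈-upTo⁺ (n<1+n n))) =
    ∈-cartesianProductWith⁺ (insertWith τ n) (∈-perms⁺ n u↭)
                            (∈-upTo⁺ (s≤s (≤-trans j≤∣u∣ (≤-reflexive (↭-upTo⇒length u↭)))))
    where
    u↭ : u ↭ upTo n
    u↭ = drop-∷ (↭-trans (↭-sym (insert-↭ n u j)) (↭-trans w↭ (upTo-suc-↭ n)))

  perms-unique : ∀ n → Unique (perms n)
  perms-unique zero    = [] ∷ []
  perms-unique (suc n) =
    cartesianProductWith⁺-retraction (insertWith τ n) (remove n) remove∘insert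
                                     (perms-unique n) (Unique.upTo⁺ (suc n))
    where
    remove∘insert : ∀ {u j} → u ∈ perms n → j ∈ upTo (suc n) → remove n (insertWith τ n u j) ≡ (u , j)
    remove∘insert u∈ j∈ = remove-insert _ _
      (λ n∈u → <-irrefl refl (All.lookup (↭-upTo⇒All< (∈-perms⁻ n u∈)) n∈u))
      (≤-trans (s≤s⁻¹ (∈-upTo⁻ j∈)) (≤-reflexive (sym (↭-upTo⇒length (∈-perms⁻ n u∈)))))

  map-perms-↭-eulerian : (stat : List ℕ → ℕ) → stat [] ≡ 0 →
    (∀ {n w} → w ↭ upTo n →
       applyUpTo (stat ∘ insertWith τ n w) (suc (length w)) ↭ eulerianStep (stat w) (length w)) →
    ∀ n → map stat (perms n) ↭ eulerian n
  map-perms-↭-eulerian stat stat[]≡0 _ zero = ↭-reflexive (cong [_] stat[]≡0)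
  map-perms-↭-eulerian stat stat[]≡0 insertions (suc n) = begin
    map stat (cartesianProductWith (insertWith τ n) (perms n) (upTo (suc n)))
      ↭⟨ map-cartesianProductWith-↭ stat (insertWith τ n) (perms n) (upTo (suc n)) insertions-of ⟩
    concatMap (λ w → eulerianStep (stat w) n) (perms n)
      ≡⟨ cong concat (List.map-∘ (perms n)) ⟩
    concatMap (λ d → eulerianStep d n) (map stat (perms n))
      ↭⟨ concatMap⁺ (λ d → eulerianStep d n) (map-perms-↭-eulerian stat stat[]≡0 insertions n) ⟩
    eulerian (suc n) ∎
    where
    open PermutationReasoning
    insertions-of : ∀ {w} → w ∈ perms n →
                    map (stat ∘ insertWith τ n w) (upTo (suc n)) ↭ eulerianStep (stat w) n
    insertions-of {w} w∈ with w↭ ← ∈-perms⁻ n w∈ =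
      ↭-trans (↭-reflexive (List.map-upTo (stat ∘ insertWith τ n w) (suc n)))
              (subst (λ m → applyUpTo (stat ∘ insertWith τ n w) (suc m) ↭ eulerianStep (stat w) m)
                     (↭-upTo⇒length w↭) (insertions w↭))

  ↭-perms : ∀ n {ws} → Unique ws →
            (∀ {w} → w ∈ ws → w ↭ upTo n) → (∀ {w} → w ↭ upTo n → w ∈ ws) → ws ↭ perms n
  ↭-perms n ws! sound complete =
    ∼bag⇒↭ (unique∧set⇒bag ws! (perms-unique n) (mk⇔ (∈-perms⁺ n ∘ sound) (complete ∘ ∈-perms⁻ n)))

module Insertion      = InsertionEnumeration id id (λ _ → refl) (λ _ → refl) (λ _ → ↭-refl)
module CycleInsertion =
  InsertionEnumeration rotateLeft rotateRight rotateRight∘rotateLeft rotateLeft∘rotateRight rotateLeft-↭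

map-des-↭-eulerian : ∀ n → map (desAfter 0) (Insertion.perms n) ↭ eulerian n
map-des-↭-eulerian = Insertion.map-perms-↭-eulerian (desAfter 0) refl
  (λ w↭ → desAfter-insertAt _ z≤n (↭-upTo⇒All< w↭))

map-exc-↭-eulerian : ∀ n → map (excFrom 0) (CycleInsertion.perms n) ↭ eulerian n
map-exc-↭-eulerian = CycleInsertion.map-perms-↭-eulerian (excFrom 0) refl
  (λ w↭ → excFrom-cycleInsert 0 _ (↭-upTo⇒length w↭) (↭-upTo⇒All< w↭))

toℕs : ∀ {n m} → Vec (Fin n) m → List ℕ
toℕs π = map toℕ (toList π)

toℕs-injective : ∀ {n m} {π σ : Vec (Fin n) m} → toℕs π ≡ toℕs σ → π ≡ σ
toℕs-injective {π = []}    {[]}    _  = refl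
toℕs-injective {π = a ∷ π} {b ∷ σ} eq with a≡b , π≡σ ← List.∷-injective eq =
  cong₂ _∷_ (toℕ-injective a≡b) (toℕs-injective π≡σ)

length-toℕs : ∀ {n m} (π : Vec (Fin n) m) → length (toℕs π) ≡ m
length-toℕs π = trans (List.length-map toℕ (toList π)) (Vec.length-toList π)

toℕs-⊆-upTo : ∀ {n m} (π : Vec (Fin n) m) {x} → x ∈ toℕs π → x ∈ upTo n
toℕs-⊆-upTo π x∈ with a , _ , refl ← ∈-map⁻ toℕ x∈ = ∈-upTo⁺ (toℕ<n a)

fromℕs : ∀ {n m} (w : List ℕ) → All (_< n) w → length w ≡ m → ∃ λ (π : Vec (Fin n) m) → toℕs π ≡ w
fromℕs []      []           refl = [] , refl
fromℕs (x ∷ w) (x<n ∷ w<n) refl with π , toℕs-π≡w ← fromℕs w w<n refl =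
  fromℕ< x<n ∷ π , cong₂ _∷_ (toℕ-fromℕ< x<n) toℕs-π≡w

allVecs-suc : (xs : List A) (n : ℕ) → allVecs xs (suc n) ≡ cartesianProductWith _∷_ xs (allVecs xs n)
allVecs-suc xs n = concatMap-map≡cartesianProductWith _∷_ xs (allVecs xs n)

allVecs-unique : {xs : List A} → Unique xs → ∀ n → Unique (allVecs xs n)
allVecs-unique         xs! zero    = [] ∷ []
allVecs-unique {xs = xs} xs! (suc n) rewrite allVecs-suc xs n =
  Unique.cartesianProductWith⁺ _∷_ Vec.∷-injective xs! (allVecs-unique xs! n)

∈-allVecs : {xs : List A} → (∀ x → x ∈ xs) → ∀ {n} (v : Vec A n) → v ∈ allVecs xs n
∈-allVecs         _   []      = here refl
∈-allVecs {xs = xs} all∈ {suc n} (x ∷ v) rewrite allVecs-suc xs n =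
  ∈-cartesianProductWith⁺ _∷_ (all∈ x) (∈-allVecs all∈ v)

permutations : (n : ℕ) → List (Vec (Fin n) n)
permutations n = filter isPerm? (allVecs (allFin n) n)

∈-permutations⇒IsPerm : ∀ {n} {π : Vec (Fin n) n} → π ∈ permutations n → IsPerm π
∈-permutations⇒IsPerm {n} π∈ = proj₂ (∈-filter⁻ isPerm? {xs = allVecs (allFin n) n} π∈)

IsPerm⇒Unique : ∀ {n} {π : Vec (Fin n) n} → IsPerm π → Unique (toℕs π)
IsPerm⇒Unique = Unique.map⁺ toℕ-injective

toℕs-permutations-unique : ∀ n → Unique (map toℕs (permutations n))
toℕs-permutations-unique n =
  Unique.map⁺ toℕs-injective (Unique.filter⁺ isPerm? (allVecs-unique (Unique.allFin⁺ n) n))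

∈-toℕs-permutations⁻ : ∀ n {w} → w ∈ map toℕs (permutations n) → w ↭ upTo n
∈-toℕs-permutations⁻ n w∈ with π , π∈ , refl ← ∈-map⁻ toℕs w∈ =
  unique-⊆-length⇒↭ (upTo n) (IsPerm⇒Unique (∈-permutations⇒IsPerm π∈)) (toℕs-⊆-upTo π)
    (≤-reflexive (trans (List.length-upTo n) (sym (length-toℕs π))))

∈-toℕs-permutations⁺ : ∀ n {w} → w ↭ upTo n → w ∈ map toℕs (permutations n)
∈-toℕs-permutations⁺ n {w} w↭ with π , refl ← fromℕs w (↭-upTo⇒All< w↭) (↭-upTo⇒length w↭) =
  ∈-map⁺ toℕs (∈-filter⁺ isPerm? (∈-allVecs ∈-allFin π) (Unique.map⁻ toℕs-unique))
  where
  toℕs-unique : Unique (toℕs π)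
  toℕs-unique = Unique-resp-↭ (↭-sym w↭) (Unique.upTo⁺ n)

excList≡excFrom : ∀ {n} i (ps : List (Fin n)) → excList i ps ≡ excFrom i (map toℕ ps)
excList≡excFrom i []       = refl
excList≡excFrom i (p ∷ ps) with i <? toℕ p
... | yes _ = cong suc (excList≡excFrom (suc i) ps)
... | no  _ = excList≡excFrom (suc i) ps

desFrom≡desAfter : ∀ {n r m} (a : Fin n) (c : Fin r) (π : Vec (Fin n) m) (z : Vec (Fin r) m) →
  Unique (a ∷ toList π) → desFrom (a , c) (toList (zip π z)) ≡ desAfter (toℕ a) (toℕs π)
desFrom≡desAfter a c []      []      _                      = refl
desFrom≡desAfter a c (b ∷ π) (d ∷ z) ((a≢b ∷ _) ∷ b∷π!) with (a , c) >F? (b , d)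
... | yes (inj₁ b<a)       = cong₂ _+_ (sym (𝟙-yes (toℕ b <? toℕ a) b<a)) (desFrom≡desAfter b d π z b∷π!)
... | yes (inj₂ (a≡b , _)) = contradiction (toℕ-injective a≡b) a≢b
... | no  a≯b              = cong₂ _+_ (sym (𝟙-no (toℕ b <? toℕ a) (a≯b ∘ inj₁)))
                                       (desFrom≡desAfter b d π z b∷π!)

des-F≡desAfter : ∀ {n r} (z : Vec (Fin r) n) (π : Vec (Fin n) n) → IsPerm π →
                 des-F (z , π) ≡ desAfter 0 (toℕs π)
des-F≡desAfter []      []      _  = refl
des-F≡desAfter (c ∷ z) (a ∷ π) π! = desFrom≡desAfter a c π z π!

map-exc↭map-des : ∀ n → map exc (permutations n) ↭ map (desAfter 0 ∘ toℕs) (permutations n)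
map-exc↭map-des n = begin
  map exc Sₙ                               ≡⟨ List.map-cong (excList≡excFrom 0 ∘ toList) Sₙ ⟩
  map (excFrom 0 ∘ toℕs) Sₙ                ≡⟨ List.map-∘ Sₙ ⟩
  map (excFrom 0) (map toℕs Sₙ)            ↭⟨ map⁺ (excFrom 0) toℕs-Sₙ↭cycleInsertions ⟩
  map (excFrom 0) (CycleInsertion.perms n) ↭⟨ map-exc-↭-eulerian n ⟩
  eulerian n                               ↭⟨ map-des-↭-eulerian n ⟨
  map (desAfter 0) (Insertion.perms n)     ↭⟨ map⁺ (desAfter 0) toℕs-Sₙ↭insertions ⟨
  map (desAfter 0) (map toℕs Sₙ)           ≡⟨ List.map-∘ Sₙ ⟨
  map (desAfter 0 ∘ toℕs) Sₙ               ∎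
  where
  open PermutationReasoning
  Sₙ : List (Vec (Fin n) n)
  Sₙ = permutations n
  toℕs-Sₙ↭cycleInsertions : map toℕs Sₙ ↭ CycleInsertion.perms n
  toℕs-Sₙ↭cycleInsertions = CycleInsertion.↭-perms n
    (toℕs-permutations-unique n) (∈-toℕs-permutations⁻ n) (∈-toℕs-permutations⁺ n)
  toℕs-Sₙ↭insertions : map toℕs Sₙ ↭ Insertion.perms n
  toℕs-Sₙ↭insertions = Insertion.↭-perms n
    (toℕs-permutations-unique n) (∈-toℕs-permutations⁻ n) (∈-toℕs-permutations⁺ n)

G≡cartesianProduct : ∀ r n → G r n ≡ cartesianProduct (allVecs (allFin r) n) (permutations n)
G≡cartesianProduct r n = concatMap-map≡cartesianProductWith _,_ (allVecs (allFin r) n) (permutations n)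

map-exc-r↭map-ldes-F : ∀ r n → map exc-r (G r n) ↭ map ldes-F (G r n)
map-exc-r↭map-ldes-F r n rewrite G≡cartesianProduct r n = begin
  map exc-r (cartesianProduct Zs Sₙ)
    ↭⟨ map-cartesianProductWith-↭ exc-r _,_ Zs Sₙ (λ {z} _ → fixed-colouring z) ⟩
  concatMap (λ z → map (ldes-F ∘ (z ,_)) Sₙ) Zs
    ↭⟨ map-cartesianProductWith-↭ ldes-F _,_ Zs Sₙ (λ _ → ↭-refl) ⟨
  map ldes-F (cartesianProduct Zs Sₙ) ∎
  where
  open PermutationReasoning
  Zs : List (Vec (Fin r) n)
  Zs = allVecs (allFin r) n
  Sₙ : List (Vec (Fin n) n)
  Sₙ = permutations n
  fixed-colouring : ∀ z → map (exc-r ∘ (z ,_)) Sₙ ↭ map (ldes-F ∘ (z ,_)) Sₙ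
  fixed-colouring z = begin
    map (exc-r ∘ (z ,_)) Sₙ                  ≡⟨ List.map-∘ Sₙ ⟩
    map (_+ c) (map exc Sₙ)                   ↭⟨ map⁺ (_+ c) (map-exc↭map-des n) ⟩
    map (_+ c) (map (desAfter 0 ∘ toℕs) Sₙ)   ≡⟨ List.map-∘ Sₙ ⟨
    map (λ π → desAfter 0 (toℕs π) + c) Sₙ    ≡⟨ List.map-cong-local (All.tabulate des-F≡desAfter-on-Sₙ) ⟩
    map (ldes-F ∘ (z ,_)) Sₙ                  ∎
    where
    c : ℕ
    c = sum (map toℕ (toList z))
    des-F≡desAfter-on-Sₙ : ∀ {π} → π ∈ Sₙ → desAfter 0 (toℕs π) + c ≡ ldes-F (z , π)
    des-F≡desAfter-on-Sₙ π∈ = cong (_+ c) (sym (des-F≡desAfter z _ (∈-permutations⇒IsPerm π∈)))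

mainTheorem15 : (r n : ℕ) → 1 ≤ r → 1 ≤ n →
    (k : ℕ) → coeff r n exc-r k ≡ coeff r n ldes-F k
mainTheorem15 r n _ _ k = count-↭ exc-r ldes-F k (G r n) (map-exc-r↭map-ldes-F r n)
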